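{- Let $X$ be a cubic symmetric graph of order $2n$ and let $G\le\mathrm{Aut}(X)$ be a subgroup acting regularly on the arcs of $X$. Then $G$ contains an automorphism acting as an odd permutation on $V(X)$ if and only if $n$ is odd.
   Context: A cubic symmetric graph is a finite, simple, connected graph with all vertex degrees $3$ whose automorphism group acts transitively on arcs (ordered pairs of adjacent vertices). Acting regularly means transitively with trivial stabilizers. -}

module Defs where

open import Data.Bool.Base using (Bool; true; false; T; _∧_)
open import Data.Nat.Base using (ℕ; _<ᵇ_; _%_)
open import Data.Fin.Base using (Fin; toℕ)
open import Data.List.Base using (List; length; filterᵇ; cartesianProduct; allFin)
open import Data.Product.Base using (Σ; _×_; _,_; ∃)
open import Data.Fin.Permutation using (Permutation′; _⟨$⟩ʳ_; id; flip; _∘ₚ_; _≈_)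
open import Relation.Binary.PropositionalEquality using (_≡_)

record SimpleGraph (m : ℕ) : Set where
  field
    adj     : Fin m → Fin m → Bool
    adj-sym : ∀ u v → adj u v ≡ adj v u
    adj-irr : ∀ u → adj u u ≡ false

module _ {m : ℕ} (X : SimpleGraph m) where
  open SimpleGraph X

  Adj : Fin m → Fin m → Set
  Adj u v = T (adj u v)

  degree : Fin m → ℕ
  degree u = length (filterᵇ (adj u) (allFin m))

  Cubic : Set
  Cubic = ∀ u → degree u ≡ 3

  data Reach : Fin m → Fin m → Set where
    here : ∀ {u} → Reach u u
    step : ∀ {u v w} → Adj u v → Reach v w → Reach u w

  Connected : Set
  Connected = ∀ u v → Reach u v

  IsAut : Permutation′ m → Set
  IsAut σ = ∀ u v → adj (σ ⟨$⟩ʳ u) (σ ⟨$⟩ʳ v) ≡ adj u v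

  Arc : Set
  Arc = Σ (Fin m × Fin m) (λ { (u , v) → Adj u v })

  MapsArc : Permutation′ m → Arc → Arc → Set
  MapsArc σ ((u , v) , _) ((u' , v') , _) = (σ ⟨$⟩ʳ u ≡ u') × (σ ⟨$⟩ʳ v ≡ v')

  ArcTransitive : Set
  ArcTransitive = ∀ (a b : Arc) → ∃ λ σ → IsAut σ × MapsArc σ a b

  CubicSymmetric : Set
  CubicSymmetric = Cubic × Connected × ArcTransitive

  -- a subgroup G ≤ Aut(X), given as a predicate on permutations of V(X)
  -- (closed under pointwise equality, since permutations are compared extensionally)
  record IsAutSubgroup (G : Permutation′ m → Set) : Set where
    field
      ⊆Aut   : ∀ σ → G σ → IsAut σ
      resp-≈ : ∀ σ τ → σ ≈ τ → G σ → G τ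
      id∈    : G id
      ∘∈     : ∀ σ τ → G σ → G τ → G (σ ∘ₚ τ)
      inv∈   : ∀ σ → G σ → G (flip σ)

  ArcRegular : (Permutation′ m → Set) → Set
  ArcRegular G =
    (∀ (a b : Arc) → ∃ λ σ → G σ × MapsArc σ a b) ×
    (∀ (a : Arc) σ → G σ → MapsArc σ a a → σ ≈ id)

inversions : ∀ {m} → Permutation′ m → ℕ
inversions {m} σ =
  length (filterᵇ (λ { (i , j) → (toℕ i <ᵇ toℕ j) ∧ (toℕ (σ ⟨$⟩ʳ j) <ᵇ toℕ (σ ⟨$⟩ʳ i)) })
                  (cartesianProduct (allFin m) (allFin m)))

OddPerm : ∀ {m} → Permutation′ m → Set
OddPerm σ = inversions σ % 2 ≡ 1

-- Signs of permutations are computed in 𝔽₂ as sums of inversions.  The main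
-- counting tool is pairing: in an 𝔽₂-sum over a symmetric matrix the
-- off-diagonal terms cancel.  From it we get that the sign is a homomorphism,
-- that a fixed-point-free involution of 2n points has sign parity n, and that
-- an involution preserving an odd set fixes a point of it.
--
-- For the graph: the element of G reversing an edge is a fixed-point-free
-- involution (an involution of G fixing a vertex fixes one of its 3
-- neighbours, hence an arc, hence is trivial), so it has sign parity n.
-- A vertex stabiliser element h has h, h² or h³ fixing an arc, so it is even.
-- As X is connected, every element of G is a product of edge reversals and a
-- stabiliser element; so if n is even G is even, and if n is odd any edge
-- reversal is odd.
module Submission where

open import Defs
open import Algebra.Bundles using (CommutativeRing)
import Algebra.Properties.CommutativeMonoid.Sum as CommutativeMonoidSum
open import Data.Bool.Base using (Bool; true; false; T; not; _∧_; _xor_)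
open import Data.Bool.Properties
  using ( xor-∧-commutativeRing; xor-assoc; xor-same; xor-identityʳ; not-distribˡ-xor
        ; not-involutive; ∧-comm; ∧-idem; ∧-identityʳ; ∧-distribˡ-xor; ∧-distribʳ-xor; T-≡ )
open import Data.Empty using (⊥-elim)
open import Data.Fin.Base using (Fin; zero; suc; toℕ)
open import Data.Fin.Properties using (_≟_; <-cmp)
open import Data.Fin.Permutation
  using (Permutation′; _⟨$⟩ʳ_; id; flip; _∘ₚ_; _≈_; inverseˡ; inverseʳ)
open import Data.List.Base using (List; []; _∷_; _++_; length; filterᵇ; tabulate; cartesianProduct; map)
open import Data.List.Properties using (length-++; filter-++; map-tabulate)
open import Data.List.Relation.Unary.All as All using (All; []; _∷_)
open import Data.List.Relation.Unary.Unique.Propositional using (Unique; []; _∷_)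
open import Data.Nat.Base using (ℕ; zero; suc; _+_; _*_; _%_; _<_; _<ᵇ_; _≤_; z≤n; s≤s)
import Data.Nat.Properties as ℕ
open import Algebra.Properties.CommutativeSemigroup ℕ.+-commutativeSemigroup
  using () renaming (interchange to +-interchange)
open import Data.Product.Base using (∃; _×_; _,_; proj₁; proj₂)
open import Data.Sum.Base using (_⊎_; inj₁; inj₂)
open import Function.Base using (_∘_)
open import Function.Bundles using (_⇔_; mk⇔; Equivalence; Injection)
open import Function.Properties.Inverse using (↔⇒↣)
open import Relation.Binary.Definitions using (tri<; tri≈; tri>)
open import Relation.Binary.PropositionalEquality
open import Relation.Nullary using (Dec; does; _because_; ¬_; yes; no; contradiction)
open import Relation.Nullary.Decidable using (T?; dec-true; dec-false)

parity : ℕ → Bool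
parity zero    = false
parity (suc n) = not (parity n)

parity-+ : ∀ a b → parity (a + b) ≡ parity a xor parity b
parity-+ zero    b = refl
parity-+ (suc a) b = trans (cong not (parity-+ a b)) (not-distribˡ-xor (parity a) (parity b))

bit : Bool → ℕ
bit false = 0
bit true  = 1

parity-bit : ∀ b → parity (bit b) ≡ b
parity-bit false = refl
parity-bit true  = refl

%2≡1⇔parity : ∀ n → (n % 2 ≡ 1) ⇔ (parity n ≡ true)
%2≡1⇔parity n = mk⇔ (λ odd → bit-1 (trans (sym (%2≡bit n)) odd)) (λ p → trans (%2≡bit n) (cong bit p))
  where
  %2≡bit : ∀ n → n % 2 ≡ bit (parity n)
  %2≡bit zero          = refl
  %2≡bit (suc zero)    = refl
  %2≡bit (suc (suc n)) = trans (%2≡bit n) (cong bit (sym (not-involutive (parity n))))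

  bit-1 : ∀ {b} → bit b ≡ 1 → b ≡ true
  bit-1 {true} _ = refl

module 𝔽₂ = CommutativeMonoidSum (CommutativeRing.+-commutativeMonoid xor-∧-commutativeRing)
module ℕΣ = CommutativeMonoidSum ℕ.+-0-commutativeMonoid

⨁ : ∀ {k} → (Fin k → Bool) → Bool
⨁ = 𝔽₂.sum

∑ : ∀ {k} → (Fin k → ℕ) → ℕ
∑ = ℕΣ.sum

count : ∀ {k} → (Fin k → Bool) → ℕ
count p = ∑ (λ i → bit (p i))

parity-∑ : ∀ {k} (f : Fin k → ℕ) → parity (∑ f) ≡ ⨁ (λ i → parity (f i))
parity-∑ {zero}  f = refl
parity-∑ {suc k} f = trans (parity-+ (f zero) _) (cong (parity (f zero) xor_) (parity-∑ {k} (f ∘ suc)))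

parity-count : ∀ {k} (p : Fin k → Bool) → parity (count p) ≡ ⨁ p
parity-count {k} p = trans (parity-∑ {k} (λ i → bit (p i))) (𝔽₂.sum-cong-≗ (λ i → parity-bit (p i)))

⨁-witness : ∀ {k} (p : Fin k → Bool) → ⨁ p ≡ true → ∃ λ i → p i ≡ true
⨁-witness {suc k} p sum≡true with p zero in p₀
... | true  = zero , p₀
... | false = let i , pi = ⨁-witness {k} (p ∘ suc) sum≡true in suc i , pi

⨁-delta : ∀ {k} (a : Fin k) (h : Fin k → Bool) → ⨁ (λ j → does (a ≟ j) ∧ h j) ≡ h a
⨁-delta {suc k} zero    h = trans (cong (h zero xor_) (𝔽₂.sum-replicate-zero k)) (xor-identityʳ (h zero))
⨁-delta {suc k} (suc a) h = ⨁-delta {k} a (h ∘ suc)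

⨁² : ∀ {k} → (Fin k → Fin k → Bool) → Bool
⨁² H = ⨁ (λ i → ⨁ (λ j → H i j))

⨁²-cong : ∀ {k} {H H′ : Fin k → Fin k → Bool} → (∀ i j → H i j ≡ H′ i j) → ⨁² H ≡ ⨁² H′
⨁²-cong H≡H′ = 𝔽₂.sum-cong-≗ (λ i → 𝔽₂.sum-cong-≗ (H≡H′ i))

⨁²-xor : ∀ {k} (H H′ : Fin k → Fin k → Bool) → ⨁² (λ i j → H i j xor H′ i j) ≡ ⨁² H xor ⨁² H′
⨁²-xor {k} H H′ = trans (𝔽₂.sum-cong-≗ (λ i → 𝔽₂.∑-distrib-+ (H i) (H′ i)))
                        (𝔽₂.∑-distrib-+ {k} (λ i → ⨁ (H i)) (λ i → ⨁ (H′ i)))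

⨁²-permute : ∀ {k} (H : Fin k → Fin k → Bool) (π : Permutation′ k) →
             ⨁² H ≡ ⨁² (λ i j → H (π ⟨$⟩ʳ i) (π ⟨$⟩ʳ j))
⨁²-permute H π = trans (𝔽₂.sum-cong-≗ (λ i → 𝔽₂.sum-permute (H i) π)) (𝔽₂.sum-permute _ π)

_<ᶠ_ : ∀ {k} → Fin k → Fin k → Bool
i <ᶠ j = toℕ i <ᵇ toℕ j

<ᶠ-dec : ∀ {k} (i j : Fin k) → Dec (toℕ i < toℕ j)
<ᶠ-dec i j = (i <ᶠ j) because ℕ.<ᵇ-reflects-< (toℕ i) (toℕ j)

<ᶠ-irrefl : ∀ {k} (i : Fin k) → i <ᶠ i ≡ false
<ᶠ-irrefl i = dec-false (<ᶠ-dec i i) (ℕ.<-irrefl refl)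

<ᶠ⇒≢ : ∀ {k} {i j : Fin k} → i <ᶠ j ≡ true → ¬ i ≡ j
<ᶠ⇒≢ {i = i} i<j refl with () ← trans (sym i<j) (<ᶠ-irrefl i)

data Order {k} (i j : Fin k) : Set where
  less    : i <ᶠ j ≡ true  → j <ᶠ i ≡ false → does (i ≟ j) ≡ false → Order i j
  greater : i <ᶠ j ≡ false → j <ᶠ i ≡ true  → does (i ≟ j) ≡ false → Order i j
  equal   : i ≡ j → Order i j

compare : ∀ {k} (i j : Fin k) → Order i j
compare i j with <-cmp i j
... | tri< i<j i≢j j≮i = less (dec-true (<ᶠ-dec i j) i<j) (dec-false (<ᶠ-dec j i) j≮i) (dec-false (i ≟ j) i≢j)
... | tri> i≮j i≢j j<i = greater (dec-false (<ᶠ-dec i j) i≮j) (dec-true (<ᶠ-dec j i) j<i) (dec-false (i ≟ j) i≢j)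
... | tri≈ _   i≡j _   = equal i≡j

trichotomy : ∀ {k} (i j : Fin k) x → x ≡ (i <ᶠ j ∧ x) xor ((j <ᶠ i ∧ x) xor (does (i ≟ j) ∧ x))
trichotomy i j x with compare i j
... | less    i<j j≮i i≢j rewrite i<j | j≮i | i≢j = sym (xor-identityʳ x)
... | greater i≮j j<i i≢j rewrite i≮j | j<i | i≢j = sym (xor-identityʳ x)
... | equal refl rewrite <ᶠ-irrefl i | dec-true (i ≟ i) refl = refl

xor-cancelˡ : ∀ a b → a xor (a xor b) ≡ b
xor-cancelˡ a b = trans (sym (xor-assoc a a b)) (cong (_xor b) (xor-same a))

xor≡false⇒≡ : ∀ {a b} → a xor b ≡ false → a ≡ b
xor≡false⇒≡ {false} {false} _ = refl
xor≡false⇒≡ {true}  {true}  _ = refl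

-- Pairing: in the 𝔽₂-sum of a symmetric matrix the off-diagonal entries
-- cancel in pairs (i , j), (j , i), leaving the trace.
⨁²-symmetric : ∀ {k} (H : Fin k → Fin k → Bool) → (∀ i j → H i j ≡ H j i) → ⨁² H ≡ ⨁ (λ i → H i i)
⨁²-symmetric H sym-H = begin
  ⨁² H
    ≡⟨ ⨁²-cong (λ i j → trichotomy i j (H i j)) ⟩
  ⨁² (λ i j → (i <ᶠ j ∧ H i j) xor ((j <ᶠ i ∧ H i j) xor (does (i ≟ j) ∧ H i j)))
    ≡⟨ trans (⨁²-xor upper (λ i j → lower i j xor diagonal i j)) (cong (Upper xor_) (⨁²-xor lower diagonal)) ⟩
  Upper xor (Lower xor Diagonal)
    ≡⟨ cong (λ l → Upper xor (l xor Diagonal)) lower≡upper ⟩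
  Upper xor (Upper xor Diagonal)
    ≡⟨ xor-cancelˡ Upper Diagonal ⟩
  Diagonal
    ≡⟨ 𝔽₂.sum-cong-≗ (λ i → ⨁-delta i (H i)) ⟩
  ⨁ (λ i → H i i) ∎
  where
  open ≡-Reasoning
  upper lower diagonal : Fin _ → Fin _ → Bool
  upper    i j = i <ᶠ j ∧ H i j
  lower    i j = j <ᶠ i ∧ H i j
  diagonal i j = does (i ≟ j) ∧ H i j
  Upper Lower Diagonal : Bool
  Upper    = ⨁² upper
  Lower    = ⨁² lower
  Diagonal = ⨁² diagonal
  lower≡upper : Lower ≡ Upper
  lower≡upper = trans (𝔽₂.∑-comm lower) (⨁²-cong (λ i j → cong (i <ᶠ j ∧_) (sym-H j i)))

-- An involution γ of Fin k leaving a family f invariant, where f has odd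
-- support, fixes a point of that support: pair i with γ i.
involution-fixed-point : ∀ {k} (γ : Fin k → Fin k) → (∀ i → γ (γ i) ≡ i) →
  (f : Fin k → Bool) → (∀ i → f (γ i) ≡ f i) → ⨁ f ≡ true → ∃ λ i → γ i ≡ i × f i ≡ true
involution-fixed-point γ γγ f f∘γ odd =
  let i , Hii≡true = ⨁-witness (λ i → H i i) (trans (sym (⨁²-symmetric H H-sym)) (trans rows odd))
  in i , fixed i Hii≡true
  where
  H : Fin _ → Fin _ → Bool
  H i j = does (γ i ≟ j) ∧ f i

  H-sym : ∀ i j → H i j ≡ H j i
  H-sym i j with γ i ≟ j | γ j ≟ i
  ... | yes refl | yes _    = sym (f∘γ i)
  ... | no  _    | no  _    = refl
  ... | yes refl | no  γγ≢  = ⊥-elim (γγ≢ (γγ i))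
  ... | no  γi≢  | yes refl = ⊥-elim (γi≢ (γγ j))

  rows : ⨁² H ≡ ⨁ f
  rows = 𝔽₂.sum-cong-≗ (λ i → ⨁-delta (γ i) (λ _ → f i))

  fixed : ∀ i → H i i ≡ true → γ i ≡ i × f i ≡ true
  fixed i Hii with γ i ≟ i | f i
  ... | yes γi≡i | true = γi≡i , refl

⟨$⟩ʳ-injective : ∀ {k} (σ : Permutation′ k) {i j} → σ ⟨$⟩ʳ i ≡ σ ⟨$⟩ʳ j → i ≡ j
⟨$⟩ʳ-injective σ = Injection.injective (↔⇒↣ σ)

inversion : ∀ {k} → Permutation′ k → Fin k → Fin k → Bool
inversion σ i j = i <ᶠ j ∧ (σ ⟨$⟩ʳ j) <ᶠ (σ ⟨$⟩ʳ i)

sign : ∀ {k} → Permutation′ k → Bool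
sign σ = ⨁² (inversion σ)

sign-cong : ∀ {k} {σ τ : Permutation′ k} → σ ≈ τ → sign σ ≡ sign τ
sign-cong σ≈τ = ⨁²-cong (λ i j → cong₂ (λ a b → i <ᶠ j ∧ b <ᶠ a) (σ≈τ i) (σ≈τ j))

discord : ∀ {k} → Permutation′ k → Fin k → Fin k → Bool
discord σ i j = i <ᶠ j xor (σ ⟨$⟩ʳ i) <ᶠ (σ ⟨$⟩ʳ j)

-- Since σ is injective, an inversion is a discordant pair in increasing order.
inversion≡discord : ∀ {k} (σ : Permutation′ k) i j → inversion σ i j ≡ i <ᶠ j ∧ discord σ i j
inversion≡discord σ i j with compare i j
... | greater i≮j _ _ rewrite i≮j = refl
... | equal refl rewrite <ᶠ-irrefl i = refl
... | less i<j _ _ rewrite i<j with compare (σ ⟨$⟩ʳ i) (σ ⟨$⟩ʳ j)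
...   | less    σi<σj σj≮σi _ rewrite σi<σj | σj≮σi = refl
...   | greater σi≮σj σj<σi _ rewrite σi≮σj | σj<σi = refl
...   | equal σi≡σj = ⊥-elim (<ᶠ⇒≢ i<j (⟨$⟩ʳ-injective σ σi≡σj))

discord-sym : ∀ {k} (σ : Permutation′ k) i j → discord σ i j ≡ discord σ j i
discord-sym σ i j with compare i j | compare (σ ⟨$⟩ʳ i) (σ ⟨$⟩ʳ j)
... | equal refl | _ = refl
... | less    a b _ | less    c d _ rewrite a | b | c | d = refl
... | less    a b _ | greater c d _ rewrite a | b | c | d = refl
... | greater a b _ | less    c d _ rewrite a | b | c | d = refl
... | greater a b _ | greater c d _ rewrite a | b | c | d = refl
... | less    i<j _ _ | equal σi≡σj = ⊥-elim (<ᶠ⇒≢ i<j (⟨$⟩ʳ-injective σ σi≡σj))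
... | greater _ j<i _ | equal σi≡σj = ⊥-elim (<ᶠ⇒≢ j<i (⟨$⟩ʳ-injective σ (sym σi≡σj)))

discord-diagonal : ∀ {k} (σ : Permutation′ k) i → discord σ i i ≡ false
discord-diagonal σ i rewrite <ᶠ-irrefl i | <ᶠ-irrefl (σ ⟨$⟩ʳ i) = refl

discord-∘ₚ : ∀ {k} (τ σ : Permutation′ k) i j →
  discord (τ ∘ₚ σ) i j ≡ discord τ i j xor discord σ (τ ⟨$⟩ʳ i) (τ ⟨$⟩ʳ j)
discord-∘ₚ τ σ i j = sym (trans (xor-assoc a b (b xor c)) (cong (a xor_) (xor-cancelˡ b c)))
  where
  a b c : Bool
  a = i <ᶠ j
  b = (τ ⟨$⟩ʳ i) <ᶠ (τ ⟨$⟩ʳ j)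
  c = ((τ ∘ₚ σ) ⟨$⟩ʳ i) <ᶠ ((τ ∘ₚ σ) ⟨$⟩ʳ j)

sign-∘ₚ : ∀ {k} (τ σ : Permutation′ k) → sign (τ ∘ₚ σ) ≡ sign τ xor sign σ
sign-∘ₚ {k} τ σ = begin
  sign (τ ∘ₚ σ)                   ≡⟨ ⨁²-cong split ⟩
  ⨁² (λ i j → upper τ i j xor A′ i j) ≡⟨ ⨁²-xor (upper τ) A′ ⟩
  ⨁² (upper τ) xor ⨁² A′          ≡⟨ cong₂ _xor_ (sym (⨁²-cong (inversion≡discord τ))) (sym sign-σ) ⟩
  sign τ xor sign σ               ∎
  where
  open ≡-Reasoning
  upper : Permutation′ k → Fin k → Fin k → Bool
  upper π i j = i <ᶠ j ∧ discord π i j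
  D : Fin k → Fin k → Bool
  D i j = discord σ (τ ⟨$⟩ʳ i) (τ ⟨$⟩ʳ j)
  A′ : Fin k → Fin k → Bool
  A′ i j = i <ᶠ j ∧ D i j

  split : ∀ i j → inversion (τ ∘ₚ σ) i j ≡ upper τ i j xor A′ i j
  split i j = trans (inversion≡discord (τ ∘ₚ σ) i j)
                    (trans (cong (i <ᶠ j ∧_) (discord-∘ₚ τ σ i j)) (∧-distribˡ-xor (i <ᶠ j) _ _))

  -- Reindexed along τ, the inversions of σ differ from A′ by the matrix
  -- (discord τ) ∧ D, which is symmetric with zero diagonal.
  B′ : Fin k → Fin k → Bool
  B′ i j = (τ ⟨$⟩ʳ i) <ᶠ (τ ⟨$⟩ʳ j) ∧ D i j
  C : Fin k → Fin k → Bool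
  C i j = discord τ i j ∧ D i j
  C-sym : ∀ i j → C i j ≡ C j i
  C-sym i j = cong₂ _∧_ (discord-sym τ i j) (discord-sym σ (τ ⟨$⟩ʳ i) (τ ⟨$⟩ʳ j))
  A′⊕B′ : ⨁² A′ xor ⨁² B′ ≡ false
  A′⊕B′ = begin
    ⨁² A′ xor ⨁² B′                    ≡⟨ sym (⨁²-xor A′ B′) ⟩
    ⨁² (λ i j → A′ i j xor B′ i j)     ≡⟨ ⨁²-cong (λ i j → sym (∧-distribʳ-xor (D i j) (i <ᶠ j) _)) ⟩
    ⨁² C                               ≡⟨ ⨁²-symmetric C C-sym ⟩
    ⨁ (λ i → C i i)                    ≡⟨ 𝔽₂.sum-cong-≗ (λ i → cong (_∧ D i i) (discord-diagonal τ i)) ⟩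
    ⨁ {k} (λ _ → false)                ≡⟨ 𝔽₂.sum-replicate-zero k ⟩
    false                              ∎
  sign-σ : sign σ ≡ ⨁² A′
  sign-σ = begin
    sign σ                                   ≡⟨ ⨁²-cong (inversion≡discord σ) ⟩
    ⨁² (upper σ)                             ≡⟨ ⨁²-permute (upper σ) τ ⟩
    ⨁² B′                                    ≡⟨ sym (xor≡false⇒≡ A′⊕B′) ⟩
    ⨁² A′                                    ∎

sign-id : ∀ {k} → sign (id {k}) ≡ false
sign-id {k} = trans (sign-∘ₚ (id {k}) id) (xor-same (sign (id {k})))

sign-trivial : ∀ {k} (σ : Permutation′ k) → σ ≈ id → sign σ ≡ false
sign-trivial {k} σ σ≈id = trans (sign-cong {k} {σ} {id} σ≈id) (sign-id {k})

count-permute : ∀ {k} (p : Fin k → Bool) (π : Permutation′ k) → count p ≡ count (λ i → p (π ⟨$⟩ʳ i))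
count-permute p π = ℕΣ.sum-permute (λ i → bit (p i)) π

count-partition : ∀ {k} (p q : Fin k → Bool) → (∀ i → bit (p i) + bit (q i) ≡ 1) → count p + count q ≡ k
count-partition {zero}  p q one = refl
count-partition {suc k} p q one = begin
  (bit (p zero) + count (p ∘ suc)) + (bit (q zero) + count (q ∘ suc))
    ≡⟨ +-interchange (bit (p zero)) (count (p ∘ suc)) (bit (q zero)) (count (q ∘ suc)) ⟩
  (bit (p zero) + bit (q zero)) + (count (p ∘ suc) + count (q ∘ suc))
    ≡⟨ cong₂ _+_ (one zero) (count-partition (p ∘ suc) (q ∘ suc) (one ∘ suc)) ⟩
  suc k ∎
  where open ≡-Reasoning

count-tabulate : ∀ {A : Set} {k} (p : A → Bool) (f : Fin k → A) →
  length (filterᵇ p (tabulate f)) ≡ count (λ i → p (f i))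
count-tabulate {k = zero}  p f = refl
count-tabulate {k = suc k} p f with p (f zero)
... | true  = cong suc (count-tabulate p (f ∘ suc))
... | false = count-tabulate p (f ∘ suc)

count-cartesian : ∀ {A B : Set} {k l} (p : A × B → Bool) (f : Fin k → A) (g : Fin l → B) →
  length (filterᵇ p (cartesianProduct (tabulate f) (tabulate g))) ≡ ∑ (λ i → count (λ j → p (f i , g j)))
count-cartesian {k = zero}  p f g = refl
count-cartesian {A = A} {B = B} {k = suc k} p f g = begin
  length (filterᵇ p (row ++ rest))                ≡⟨ cong length (filter-++ (T? ∘ p) row rest) ⟩
  length (filterᵇ p row ++ filterᵇ p rest)        ≡⟨ length-++ (filterᵇ p row) ⟩
  length (filterᵇ p row) + length (filterᵇ p rest)
    ≡⟨ cong₂ _+_ (trans (cong (length ∘ filterᵇ p) (map-tabulate g (f zero ,_)))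
                        (count-tabulate p (λ j → f zero , g j)))
                 (count-cartesian p (f ∘ suc) g) ⟩
  ∑ (λ i → count (λ j → p (f i , g j)))          ∎
  where
  open ≡-Reasoning
  row rest : List (A × B)
  row  = map (f zero ,_) (tabulate g)
  rest = cartesianProduct (tabulate (f ∘ suc)) (tabulate g)

count-remove : ∀ {k} (p : Fin k → Bool) {a} → p a ≡ true →
  count p ≡ suc (count (λ i → p i ∧ not (does (a ≟ i))))
count-remove {suc k} p {zero} pa rewrite pa =
  cong suc (ℕΣ.sum-cong-≗ (λ i → cong bit (sym (∧-identityʳ (p (suc i))))))
count-remove {suc k} p {suc a} pa = begin
  bit (p zero) + count (p ∘ suc)           ≡⟨ cong (bit (p zero) +_) (count-remove (p ∘ suc) pa) ⟩
  bit (p zero) + suc (count rest)          ≡⟨ ℕ.+-suc (bit (p zero)) _ ⟩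
  suc (bit (p zero) + count rest)          ≡⟨ cong (λ b → suc (bit b + count rest)) (sym (∧-identityʳ (p zero))) ⟩
  suc (bit (p zero ∧ true) + count rest)   ∎
  where
  open ≡-Reasoning
  rest : Fin k → Bool
  rest i = p (suc i) ∧ not (does (a ≟ i))

length≤count : ∀ {k} (p : Fin k → Bool) (xs : List (Fin k)) →
  Unique xs → All (λ x → p x ≡ true) xs → length xs ≤ count p
length≤count p []       _                  _          = z≤n
length≤count p (a ∷ xs) (a≢xs ∷ unique-xs) (pa ∷ pxs) =
  subst (suc (length xs) ≤_) (sym (count-remove p pa))
        (s≤s (length≤count _ xs unique-xs (All.zipWith still-holds (a≢xs , pxs))))
  where
  still-holds : ∀ {x} → ¬ a ≡ x × p x ≡ true → p x ∧ not (does (a ≟ x)) ≡ true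
  still-holds {x} (a≢x , px) = trans (cong (λ b → p x ∧ not b) (dec-false (a ≟ x) a≢x)) (trans (∧-identityʳ (p x)) px)

-- A fixed-point-free involution γ of Fin (2n) is a product of n disjoint
-- transpositions, hence has the sign of parity n: its inversions pair up
-- except for the pairs (i , γ i) with i < γ i, of which there are n.
sign-involution : ∀ {k} (γ : Permutation′ k) → (∀ i → γ ⟨$⟩ʳ (γ ⟨$⟩ʳ i) ≡ i) →
  (∀ i → ¬ γ ⟨$⟩ʳ i ≡ i) → ∀ n → k ≡ 2 * n → sign γ ≡ parity n
sign-involution {k} γ γγ no-fix n k≡2n = begin
  sign γ               ≡⟨ 𝔽₂.sum-cong-≗ (λ i → 𝔽₂.sum-permute (inversion γ i) γ) ⟩
  ⨁² H                 ≡⟨ ⨁²-symmetric H H-sym ⟩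
  ⨁ (λ i → H i i)      ≡⟨ 𝔽₂.sum-cong-≗ (λ i → trans (cong (λ x → below i ∧ x <ᶠ g i) (γγ i)) (∧-idem _)) ⟩
  ⨁ below              ≡⟨ sym (parity-count below) ⟩
  parity (count below) ≡⟨ cong parity (ℕ.*-cancelˡ-≡ (count below) n 2 twice) ⟩
  parity n             ∎
  where
  open ≡-Reasoning
  g : Fin k → Fin k
  g = γ ⟨$⟩ʳ_
  H : Fin k → Fin k → Bool
  H i j = inversion γ i (g j)
  H-sym : ∀ i j → H i j ≡ H j i
  H-sym i j = begin
    i <ᶠ g j ∧ g (g j) <ᶠ g i  ≡⟨ cong (λ x → i <ᶠ g j ∧ x <ᶠ g i) (γγ j) ⟩
    i <ᶠ g j ∧ j <ᶠ g i        ≡⟨ ∧-comm (i <ᶠ g j) _ ⟩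
    j <ᶠ g i ∧ i <ᶠ g j        ≡⟨ cong (λ x → j <ᶠ g i ∧ x <ᶠ g j) (sym (γγ i)) ⟩
    j <ᶠ g i ∧ g (g i) <ᶠ g j  ∎
  below above : Fin k → Bool
  below i = i <ᶠ g i
  above i = g i <ᶠ i
  one : ∀ i → bit (below i) + bit (above i) ≡ 1
  one i with compare i (g i)
  ... | less    i<γi γi≮i _ rewrite i<γi | γi≮i = refl
  ... | greater i≮γi γi<i _ rewrite i≮γi | γi<i = refl
  ... | equal i≡γi = ⊥-elim (no-fix i (sym i≡γi))
  below≡above : count below ≡ count above
  below≡above = trans (count-permute below γ) (ℕΣ.sum-cong-≗ (λ i → cong (λ x → bit (g i <ᶠ x)) (γγ i)))
  twice : 2 * count below ≡ 2 * n
  twice = begin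
    count below + (count below + 0) ≡⟨ cong (count below +_) (trans (ℕ.+-identityʳ _) below≡above) ⟩
    count below + count above       ≡⟨ count-partition below above one ⟩
    k                               ≡⟨ k≡2n ⟩
    2 * n                           ∎

parity-inversions : ∀ {k} (σ : Permutation′ k) → parity (inversions σ) ≡ sign σ
parity-inversions {k} σ = begin
  parity (inversions σ)
    ≡⟨ cong parity (count-cartesian (λ (i , j) → inversion σ i j) (λ i → i) (λ j → j)) ⟩
  parity (∑ (λ i → count (inversion σ i)))
    ≡⟨ parity-∑ {k} (λ i → count (inversion σ i)) ⟩
  ⨁ (λ i → parity (count (inversion σ i)))
    ≡⟨ 𝔽₂.sum-cong-≗ (λ i → parity-count (inversion σ i)) ⟩
  sign σ ∎
  where open ≡-Reasoning

odd⇔sign : ∀ {k} (σ : Permutation′ k) → OddPerm σ ⇔ (sign σ ≡ true)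
odd⇔sign σ = mk⇔ (λ odd → trans (sym (parity-inversions σ)) (Equivalence.to (%2≡1⇔parity (inversions σ)) odd))
                 (λ sign≡true → Equivalence.from (%2≡1⇔parity (inversions σ)) (trans (parity-inversions σ) sign≡true))


module ArcRegularAction {m} (X : SimpleGraph m) (cubic : Cubic X) (G : Permutation′ m → Set)
                        (G≤Aut : IsAutSubgroup X G) (regular : ArcRegular X G) where
  open SimpleGraph X
  open IsAutSubgroup G≤Aut

  adjacent-distinct : ∀ {v u} → Adj X v u → ¬ v ≡ u
  adjacent-distinct {v} vu refl = subst T (adj-irr v) vu

  arc-fixer-trivial : ∀ {σ u v} → G σ → Adj X u v → σ ⟨$⟩ʳ u ≡ u → σ ⟨$⟩ʳ v ≡ v → σ ≈ id
  arc-fixer-trivial {σ} {u} {v} σ∈G uv σu σv = proj₂ regular ((u , v) , uv) σ σ∈G (σu , σv)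

  fixer-preserves-neighbourhood : ∀ {h w} → G h → h ⟨$⟩ʳ w ≡ w → ∀ x → adj w (h ⟨$⟩ʳ x) ≡ adj w x
  fixer-preserves-neighbourhood {h} h∈G hw x = trans (cong (λ z → adj z (h ⟨$⟩ʳ x)) (sym hw)) (⊆Aut h h∈G _ x)

  -- Every vertex has three neighbours: an odd number, and at least one.
  odd-neighbourhood : ∀ w → ⨁ (adj w) ≡ true
  odd-neighbourhood w =
    trans (sym (parity-count (adj w))) (cong parity (trans (sym (count-tabulate (adj w) (λ i → i))) (cubic w)))

  neighbour : ∀ w → ∃ λ u → Adj X w u
  neighbour w = let u , wu = ⨁-witness (adj w) (odd-neighbourhood w) in u , Equivalence.from T-≡ wu

  -- An involution of G fixing a vertex w permutes its odd neighbourhood, so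
  -- fixes a neighbour x of w, hence the arc (w , x): it is trivial.
  involution-fixing-vertex : ∀ {h w} → G h → (∀ i → h ⟨$⟩ʳ (h ⟨$⟩ʳ i) ≡ i) → h ⟨$⟩ʳ w ≡ w → h ≈ id
  involution-fixing-vertex {h} {w} h∈G hh hw =
    let x , hx , wx = involution-fixed-point (h ⟨$⟩ʳ_) hh (adj w) (fixer-preserves-neighbourhood h∈G hw)
                                             (odd-neighbourhood w)
    in arc-fixer-trivial h∈G (Equivalence.from T-≡ wx) hw hx

  record Reversal (v u : Fin m) : Set where
    field
      ρ    : Permutation′ m
      ρ∈G  : G ρ
      ρv≡u : ρ ⟨$⟩ʳ v ≡ u
      ρu≡v : ρ ⟨$⟩ʳ u ≡ v

  reversal : ∀ {v u} → Adj X v u → Reversal v u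
  reversal {v} {u} vu =
    let ρ , ρ∈G , ρv≡u , ρu≡v = proj₁ regular ((v , u) , vu) ((u , v) , subst T (adj-sym v u) vu)
    in record { ρ = ρ ; ρ∈G = ρ∈G ; ρv≡u = ρv≡u ; ρu≡v = ρu≡v }

  module _ {v u} (vu : Adj X v u) where
    open Reversal (reversal vu)

    reversal-involution : ∀ i → ρ ⟨$⟩ʳ (ρ ⟨$⟩ʳ i) ≡ i
    reversal-involution =
      arc-fixer-trivial (∘∈ ρ ρ ρ∈G ρ∈G) vu (trans (cong (ρ ⟨$⟩ʳ_) ρv≡u) ρu≡v)
                                            (trans (cong (ρ ⟨$⟩ʳ_) ρu≡v) ρv≡u)

    reversal-fixed-point-free : ∀ w → ¬ ρ ⟨$⟩ʳ w ≡ w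
    reversal-fixed-point-free w ρw≡w =
      adjacent-distinct vu (trans (sym (involution-fixing-vertex ρ∈G reversal-involution ρw≡w v)) ρv≡u)

    reversal-sign : ∀ n → m ≡ 2 * n → sign ρ ≡ parity n
    reversal-sign = sign-involution ρ reversal-involution reversal-fixed-point-free

  -- An element h of G fixing v permutes the three neighbours of v, so the
  -- orbit of a neighbour u under h has length at most 3.
  short-orbit : ∀ {h v u} → G h → h ⟨$⟩ʳ v ≡ v → Adj X v u →
    h ⟨$⟩ʳ u ≡ u ⊎ h ⟨$⟩ʳ (h ⟨$⟩ʳ u) ≡ u ⊎ h ⟨$⟩ʳ (h ⟨$⟩ʳ (h ⟨$⟩ʳ u)) ≡ u
  short-orbit {h} {v} {u} h∈G hv vu
    with h ⟨$⟩ʳ u ≟ u | h ⟨$⟩ʳ (h ⟨$⟩ʳ u) ≟ u | h ⟨$⟩ʳ (h ⟨$⟩ʳ (h ⟨$⟩ʳ u)) ≟ u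
  ... | yes hu≡u | _          | _  = inj₁ hu≡u
  ... | no _     | yes h²u≡u  | _  = inj₂ (inj₁ h²u≡u)
  ... | no _     | no _       | yes h³u≡u = inj₂ (inj₂ h³u≡u)
  ... | no hu≢u  | no h²u≢u   | no h³u≢u  = ⊥-elim (ℕ.<-irrefl refl (subst (4 ≤_) (cubic v) four≤degree))
    where
    hx : Fin m → Fin m
    hx = h ⟨$⟩ʳ_
    orbit : List (Fin m)
    orbit = u ∷ hx u ∷ hx (hx u) ∷ hx (hx (hx u)) ∷ []
    distinct : Unique orbit
    distinct = (hu≢u ∘ sym ∷ h²u≢u ∘ sym ∷ h³u≢u ∘ sym ∷ [])
             ∷ (hu≢u ∘ sym ∘ ⟨$⟩ʳ-injective h ∷ h²u≢u ∘ sym ∘ ⟨$⟩ʳ-injective h ∷ [])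
             ∷ (hu≢u ∘ sym ∘ ⟨$⟩ʳ-injective h ∘ ⟨$⟩ʳ-injective h ∷ [])
             ∷ [] ∷ []
    h-step : ∀ {x} → adj v x ≡ true → adj v (hx x) ≡ true
    h-step {x} vx = trans (fixer-preserves-neighbourhood h∈G hv x) vx
    neighbours : All (λ x → adj v x ≡ true) orbit
    neighbours = let vu′ = Equivalence.to T-≡ vu in
      vu′ ∷ h-step vu′ ∷ h-step (h-step vu′) ∷ h-step (h-step (h-step vu′)) ∷ []
    four≤degree : 4 ≤ degree X v
    four≤degree = subst (4 ≤_) (sym (count-tabulate (adj v) (λ i → i)))
                        (length≤count (adj v) orbit distinct neighbours)

  -- Vertex stabilisers of G are even: a stabiliser element h has h, h² or h³
  -- fixing an arc, and h is trivial in the first two cases, of order 3 in the last.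
  stabiliser-even : ∀ {h v} → G h → h ⟨$⟩ʳ v ≡ v → sign h ≡ false
  stabiliser-even {h} {v} h∈G hv with neighbour v
  ... | u , vu with short-orbit h∈G hv vu
  ... | inj₁ hu≡u = sign-trivial h (arc-fixer-trivial h∈G vu hv hu≡u)
  ... | inj₂ (inj₁ h²u≡u) =
    sign-trivial h (involution-fixing-vertex h∈G (arc-fixer-trivial (∘∈ h h h∈G h∈G) vu h²v≡v h²u≡u) hv)
    where
    h²v≡v : h ⟨$⟩ʳ (h ⟨$⟩ʳ v) ≡ v
    h²v≡v = trans (cong (h ⟨$⟩ʳ_) hv) hv
  ... | inj₂ (inj₂ h³u≡u) = begin
    sign h                         ≡⟨ cong (_xor sign h) (xor-same (sign h)) ⟨
    (sign h xor sign h) xor sign h ≡⟨ cong (_xor sign h) (sign-∘ₚ h h) ⟨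
    sign (h ∘ₚ h) xor sign h       ≡⟨ sign-∘ₚ (h ∘ₚ h) h ⟨
    sign h³                        ≡⟨ sign-trivial h³ (arc-fixer-trivial h³∈G vu h³v≡v h³u≡u) ⟩
    false                          ∎
    where
    open ≡-Reasoning
    h³ : Permutation′ m
    h³ = (h ∘ₚ h) ∘ₚ h
    h³∈G : G h³
    h³∈G = ∘∈ (h ∘ₚ h) h (∘∈ h h h∈G h∈G) h∈G
    h³v≡v : h³ ⟨$⟩ʳ v ≡ v
    h³v≡v = trans (cong (h ⟨$⟩ʳ_) (trans (cong (h ⟨$⟩ʳ_) hv) hv)) hv

  EvenReversals : Set
  EvenReversals = ∀ {v u} (vu : Adj X v u) → sign (Reversal.ρ (reversal vu)) ≡ false

  -- If all reversals are even, the ends of a walk are related by an even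
  -- element of G (compose the reversals along the walk).
  even-transport : EvenReversals → ∀ {u w} → Reach X u w → ∃ λ τ → G τ × τ ⟨$⟩ʳ u ≡ w × sign τ ≡ false
  even-transport even here = id , id∈ , refl , sign-id {m}
  even-transport even (step uv walk) with even-transport even walk
  ... | τ , τ∈G , τv≡w , τ-even =
    ρ ∘ₚ τ , ∘∈ ρ τ ρ∈G τ∈G , trans (cong (τ ⟨$⟩ʳ_) ρv≡u) τv≡w ,
    trans (sign-∘ₚ ρ τ) (cong₂ _xor_ (even uv) τ-even)
    where open Reversal (reversal uv)

  -- If moreover X is connected, every σ ∈ G is an even element composed with
  -- a stabiliser element, so G consists of even permutations.
  all-even : EvenReversals → Connected X → Fin m → ∀ σ → G σ → sign σ ≡ false
  all-even even connected v₀ σ σ∈G with even-transport even (connected v₀ (σ ⟨$⟩ʳ v₀))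
  ... | τ , τ∈G , τv₀≡σv₀ , τ-even = begin
    sign σ            ≡⟨ sign-cong {m} {σ} {h ∘ₚ τ} (λ i → sym (inverseʳ τ)) ⟩
    sign (h ∘ₚ τ)     ≡⟨ sign-∘ₚ h τ ⟩
    sign h xor sign τ ≡⟨ cong₂ _xor_ (stabiliser-even h∈G hv₀≡v₀) τ-even ⟩
    false             ∎
    where
    open ≡-Reasoning
    -- h = τ⁻¹ ∘ σ fixes v₀
    h : Permutation′ m
    h = σ ∘ₚ flip τ
    h∈G : G h
    h∈G = ∘∈ σ (flip τ) σ∈G (inv∈ τ τ∈G)
    hv₀≡v₀ : h ⟨$⟩ʳ v₀ ≡ v₀
    hv₀≡v₀ = trans (cong (flip τ ⟨$⟩ʳ_) (sym τv₀≡σv₀)) (inverseˡ τ)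

  odd-element⇔ : Connected X → Fin m → ∀ n → m ≡ 2 * n →
                 (∃ λ σ → G σ × sign σ ≡ true) ⇔ (parity n ≡ true)
  odd-element⇔ connected v₀ n m≡2n = mk⇔ to from
    where
    to : (∃ λ σ → G σ × sign σ ≡ true) → parity n ≡ true
    to (σ , σ∈G , σ-odd) with parity n in n-parity
    ... | true  = refl
    ... | false = contradiction (trans (sym σ-odd) (all-even even connected v₀ σ σ∈G)) λ ()
      where
      even : EvenReversals
      even vu = trans (reversal-sign vu n m≡2n) n-parity
    from : parity n ≡ true → ∃ λ σ → G σ × sign σ ≡ true
    from n-odd = let u , v₀u = neighbour v₀ ; open Reversal (reversal v₀u) in
      ρ , ρ∈G , trans (reversal-sign v₀u n m≡2n) n-odd

-- Proposition 4.1.  For n = 0 there are no vertices and no odd permutations.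
proposition4p1 : ∀ (n : ℕ) (X : SimpleGraph (2 * n)) → CubicSymmetric X →
    (G : Permutation′ (2 * n) → Set) → IsAutSubgroup X G → ArcRegular X G →
    ((∃ λ σ → G σ × OddPerm σ) ⇔ (n % 2 ≡ 1))
proposition4p1 zero _ _ _ _ _ = mk⇔ (λ { (_ , _ , ()) }) (λ ())
proposition4p1 n@(suc _) X (cubic , connected , _) G G≤Aut regular = mk⇔
  (λ (σ , σ∈G , σ-odd) → from (%2≡1⇔parity n) (to odd-element (σ , σ∈G , to (odd⇔sign σ) σ-odd)))
  (λ n-odd → let σ , σ∈G , σ-odd = from odd-element (to (%2≡1⇔parity n) n-odd)
             in σ , σ∈G , from (odd⇔sign σ) σ-odd)
  where
  open Equivalence
  odd-element : (∃ λ σ → G σ × sign σ ≡ true) ⇔ (parity n ≡ true)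
  odd-element = ArcRegularAction.odd-element⇔ X cubic G G≤Aut regular connected zero n refl
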